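{- Let $\mathbb{A}$ denote the ring of arithmetical functions $a:\mathbb{N}\to\mathbb{C}$ with pointwise addition and Dirichlet product $(a\star b)(n)=\sum_{d\mid n}a(d)b(n/d)$, let $I$ be its identity ($I(1)=1$, $I(n)=0$ for $n>1$), let $\mathbb{M}=\{a\in\mathbb{A}: a(1)=0\}$, and let $u$ be the constant function $u(n)=1$. Define $\log: I+\mathbb{M}\to\mathbb{M}$ by $\log(a)=\sum_{n=1}^{\infty}\frac{(-1)^{n-1}(a-I)^{\star n}}{n}$, and define $\Psi: I+\mathbb{M}\to \mathbb{M}$ by $\Psi(a)=u\star\log(a)$. Then $\Psi$ is an isomorphism from the group $(I+\mathbb{M},\star)$ to the group $(\mathbb{M},+)$. Moreover, for $a\in I+\mathbb{M}$, $a$ is multiplicative if and only if $\Psi(a)$ is additive. Consequently $\Psi$ restricts to a group isomorphism from the group $M$ of multiplicative arithmetical functions (under $\star$) onto the group $A$ of additive arithmetical functions (under $+$).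
   Context: An arithmetical function $a$ is multiplicative if $a(1)=1$ and $a(mn)=a(m)a(n)$ for all relatively prime $m,n\in\mathbb{N}$; it is additive if $a(mn)=a(m)+a(n)$ for all relatively prime $m,n\in\mathbb{N}$. $a^{\star n}$ denotes the $n$-fold Dirichlet product $a\star\cdots\star a$. The infinite series defining $\log$ converges pointwise since $(a-I)^{\star n}(m)=0$ whenever $2^n>m$ (for $a-I\in\mathbb{M}$). -}

module Defs where

open import Level using (_⊔_)
open import Data.Nat using (ℕ; zero; suc; _<_; _/_) renaming (_*_ to _*ℕ_)
open import Data.Nat.Divisibility using (_∣?_)
open import Data.Nat.Coprimality using (Coprime)
open import Data.Product using (_×_)
open import Relation.Nullary using (yes; no)
open import Algebra.Bundles using (CommutativeRing)

-- Arithmetical functions with values in a commutative ring R in which every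
-- positive integer is invertible (a ℚ-algebra; e.g. ℂ).  inv k is the
-- inverse of the integer (suc k) = k+1 in R.  Arithmetical functions are
-- functions ℕ → R; only their values at n ≥ 1 matter (value at 0 ignored).
module Arith {c ℓ} (R : CommutativeRing c ℓ) (inv : ℕ → CommutativeRing.Carrier R) where
  open CommutativeRing R

  AF : Set c
  AF = ℕ → Carrier

  natCast : ℕ → Carrier
  natCast zero = 0#
  natCast (suc n) = 1# + natCast n

  _≃_ : AF → AF → Set ℓ
  a ≃ b = ∀ n → 0 < n → a n ≈ b n

  sum1 : (ℕ → Carrier) → ℕ → Carrier
  sum1 f zero = 0#
  sum1 f (suc k) = sum1 f k + f (suc k)

  dirTerm : AF → AF → ℕ → ℕ → Carrier
  dirTerm a b n zero = 0#
  dirTerm a b n (suc k) with suc k ∣? n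
  ... | yes _ = a (suc k) * b (n / suc k)
  ... | no _ = 0#

  _⋆_ : AF → AF → AF
  (a ⋆ b) n = sum1 (dirTerm a b n) n

  _⊕_ : AF → AF → AF
  (a ⊕ b) n = a n + b n

  _⊖_ : AF → AF → AF
  (a ⊖ b) n = a n - b n

  I : AF
  I zero = 0#
  I (suc zero) = 1#
  I (suc (suc _)) = 0#

  u : AF
  u _ = 1#

  pow : AF → ℕ → AF
  pow a zero = I
  pow a (suc k) = a ⋆ pow a k

  negPow : ℕ → Carrier → Carrier
  negPow zero x = x
  negPow (suc k) x = - negPow k x

  -- coefficient (-1)^{k-1} / k for k ≥ 1
  coeff : ℕ → Carrier
  coeff zero = 0#
  coeff (suc k) = negPow k (inv k)

  -- log(a)(m) = Σ_{k≥1} (-1)^{k-1} (a-I)^{⋆k}(m) / k.  For a ∈ I+𝕄 the terms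
  -- vanish once 2^k > m, in particular for k > m, so the series is the
  -- finite sum over k = 1..m.
  logA : AF → AF
  logA a m = sum1 (λ k → coeff k * pow (a ⊖ I) k m) m

  Ψ : AF → AF
  Ψ a = u ⋆ logA a

  InIM : AF → Set ℓ
  InIM a = a 1 ≈ 1#

  InM : AF → Set ℓ
  InM a = a 1 ≈ 0#

  Multiplicative : AF → Set ℓ
  Multiplicative a = a 1 ≈ 1# ×
    (∀ m n → 0 < m → 0 < n → Coprime m n → a (m *ℕ n) ≈ a m * a n)

  Additive : AF → Set ℓ
  Additive a = ∀ m n → 0 < m → 0 < n → Coprime m n → a (m *ℕ n) ≈ a m + a n

module Submission where

-- The proof uses the derivation D a (n) = Ω(n) a(n), where Ω(n) counts prime
-- factors with multiplicity; complete additivity of Ω gives the Leibniz rule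
-- D (a ⋆ b) = D a ⋆ b + a ⋆ D b.  Differentiating the (locally finite) series
-- of log term by term and telescoping the resulting geometric series gives
-- the key identity  a ⋆ D(log a) = D a  for a ∈ I + 𝕄.  As a(1) = 1 makes a
-- cancellable for ⋆ and Ω(n) ≥ 1 is invertible for n ≥ 2, this identity
-- determines log a in 𝕄: hence log is a homomorphism, log (exp g) = g for the
-- exponential series (so log is onto 𝕄), and log is injective by induction
-- over divisors.  Ψ inherits these properties since u is ⋆-invertible (its
-- inverse μ is again a geometric series).  Finally, for coprime m, n and the
-- projection Q n (restriction to arguments coprime to n), a is multiplicative
-- on the divisors of m n iff it agrees there with Q n a ⋆ Q m a, and since Q n
-- commutes with ⋆ and log this is equivalent to additivity of Ψ a.

open import Defs
open import Data.Nat using (ℕ; zero; suc; _≤_; _<_; z≤n; s≤s; _/_; _≟_; _≤?_; _∸_; >-nonZero)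
  renaming (_+_ to _+ℕ_; _*_ to _*ℕ_)
open import Data.Nat.Properties using (≤-refl; ≤-trans; ≤-<-trans; ≤∧≢⇒<; <-irrefl; ≤-pred; m≤n⇒m≤1+n;
  suc-injective; *-cancelˡ-≡; m≤m*n; m≤n*m; ≰⇒>; ≤-reflexive; <⇒≢; *-mono-≤; *-monoˡ-<)
  renaming (*-comm to *ℕ-comm; *-assoc to *ℕ-assoc; *-zeroʳ to *ℕ-zeroʳ; *-identityʳ to *ℕ-identityʳ)
open import Data.Nat.Divisibility
  using (_∣_; _∣?_; divides; ∣⇒≤; ∣-trans; ∣-refl; ∣-antisym; m/n∣m; m∣m*n; n∣m*n; *-monoʳ-∣; 0∣⇒≡0)
open import Data.Nat.DivMod using (m*[n/m]≡n; n/n≡1; m/n≤m; m/n<m; m*n/n≡m; m≥n⇒m/n>0)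
open import Data.Nat.GCD using (gcd; gcd[m,n]∣m; gcd[m,n]∣n; gcd-greatest; c*gcd[m,n]≡gcd[cm,cn])
open import Data.Nat.Coprimality using (Coprime; coprime?; coprime-divisor; gcd≡1⇒coprime; 1-coprimeTo)
import Data.Nat.Coprimality as Cop
open import Data.Nat.Primality.Factorisation
  using (PrimeFactorisation; factorise; factorisationUnique; factors)
open import Data.Nat.ListAction.Properties using (product-++)
open import Data.Nat.Induction using (<-rec)
open import Data.List using ([]; _∷_; _++_; length)
open import Data.List.Properties using (length-++)
open import Data.List.Relation.Binary.Permutation.Propositional.Properties using (↭-length)
import Data.List.Relation.Unary.All.Properties as All
open import Data.Product using (Σ; _×_; _,_)
open import Data.Empty using (⊥-elim)
open import Relation.Nullary using (¬_; yes; no)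
open import Relation.Binary.PropositionalEquality as ≡ using (_≡_; _≢_)
open import Algebra.Bundles using (CommutativeRing)

divisor-pos : ∀ {d n} → 0 < n → d ∣ n → 0 < d
divisor-pos {zero} 0<n 0∣n = ⊥-elim (<-irrefl (≡.sym (0∣⇒≡0 0∣n)) 0<n)
divisor-pos {suc d} _ _ = s≤s z≤n

cofactor-pos : ∀ k n → 0 < n → suc k ∣ n → 0 < n / suc k
cofactor-pos k n 0<n k∣n = m≥n⇒m/n>0 (∣⇒≤ {{>-nonZero 0<n}} k∣n)

-- Ω n is the number of prime factors of n counted with multiplicity
-- (Ω 0 = 0 is a dummy value).
Ω : ℕ → ℕ
Ω zero = 0
Ω (suc n) = length (factors (factorise (suc n)))

-- Ω is completely additive: the concatenation of factorisations of m and n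
-- is a factorisation of m n, and factorisations are unique up to permutation.
Ω-* : ∀ m n → 0 < m → 0 < n → Ω (m *ℕ n) ≡ Ω m +ℕ Ω n
Ω-* (suc m) (suc n) _ _ =
  ≡.trans (↭-length (factorisationUnique (factorise (suc m *ℕ suc n)) concatenated))
        (length-++ (factors F))
  where
  F : PrimeFactorisation (suc m)
  F = factorise (suc m)
  G : PrimeFactorisation (suc n)
  G = factorise (suc n)
  concatenated : PrimeFactorisation (suc m *ℕ suc n)
  concatenated = record
    { factors = factors F ++ factors G
    ; isFactorisation = ≡.trans (≡.cong₂ _*ℕ_ (PrimeFactorisation.isFactorisation F) (PrimeFactorisation.isFactorisation G))
                              (≡.sym (product-++ (factors F) (factors G)))
    ; factorsPrime = All.++⁺ (PrimeFactorisation.factorsPrime F) (PrimeFactorisation.factorsPrime G)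
    }

Ω-pos : ∀ n → Σ ℕ λ k → Ω (suc (suc n)) ≡ suc k
Ω-pos n with factorise (suc (suc n))
... | record { factors = [] ; isFactorisation = () }
... | record { factors = _ ∷ ps } = length ps , ≡.refl

coprime-∣ : ∀ {d k n} → d ∣ k → Coprime k n → Coprime d n
coprime-∣ d∣k k⊥n (i∣d , i∣n) = k⊥n (∣-trans i∣d d∣k , i∣n)

coprime-* : ∀ {d e n} → Coprime d n → Coprime e n → Coprime (d *ℕ e) n
coprime-* {d} {e} {n} d⊥n e⊥n {i} (i∣de , i∣n) = e⊥n (coprime-divisor i⊥d i∣de , i∣n)
  where
  i⊥d : Coprime i d
  i⊥d = gcd≡1⇒coprime (d⊥n (gcd[m,n]∣n i d , ∣-trans (gcd[m,n]∣m i d) i∣n))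

coprime-divisors : ∀ {m n d₁ d₂} → Coprime m n → d₁ ∣ m → d₂ ∣ n → Coprime d₁ d₂
coprime-divisors m⊥n d₁∣m d₂∣n (i∣d₁ , i∣d₂) = m⊥n (∣-trans i∣d₁ d₁∣m , ∣-trans i∣d₂ d₂∣n)

coprime-cancel : ∀ {e d₁ d₂ n} → e ∣ d₁ *ℕ d₂ → Coprime e n → d₂ ∣ n → e ∣ d₁
coprime-cancel {e} {d₁} {d₂} e∣d₁d₂ e⊥n d₂∣n =
  coprime-divisor (λ (i∣e , i∣d₂) → e⊥n (i∣e , ∣-trans i∣d₂ d₂∣n)) (≡.subst (e ∣_) (*ℕ-comm d₁ d₂) e∣d₁d₂)

gcd-split : ∀ k m n → Coprime m n → k ∣ m *ℕ n → k ≡ gcd k m *ℕ gcd k n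
gcd-split k m n m⊥n k∣mn = ∣-antisym k∣d₁d₂ d₁d₂∣k
  where
  d₁ : ℕ
  d₁ = gcd k m
  d₂ : ℕ
  d₂ = gcd k n
  d₁d₂∣k : d₁ *ℕ d₂ ∣ k
  d₁d₂∣k with gcd[m,n]∣m k m
  ... | divides q k≡qd₁ = ≡.subst (d₁ *ℕ d₂ ∣_) (≡.trans (*ℕ-comm d₁ q) (≡.sym k≡qd₁)) (*-monoʳ-∣ d₁ d₂∣q)
    where
    d₂⊥d₁ : Coprime d₂ d₁
    d₂⊥d₁ = coprime-divisors (λ (i∣n , i∣m) → m⊥n (i∣m , i∣n)) (gcd[m,n]∣n k n) (gcd[m,n]∣n k m)
    d₂∣q : d₂ ∣ q
    d₂∣q = coprime-divisor d₂⊥d₁ (≡.subst (d₂ ∣_) (≡.trans k≡qd₁ (*ℕ-comm q d₁)) (gcd[m,n]∣m k n))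
  k∣d₁n : k ∣ d₁ *ℕ n
  k∣d₁n = ≡.subst (k ∣_) (≡.trans (≡.sym (c*gcd[m,n]≡gcd[cm,cn] n k m)) (*ℕ-comm n d₁))
                (gcd-greatest (n∣m*n n) (≡.subst (k ∣_) (*ℕ-comm m n) k∣mn))
  k∣d₁d₂ : k ∣ d₁ *ℕ d₂
  k∣d₁d₂ = ≡.subst (k ∣_) (≡.sym (c*gcd[m,n]≡gcd[cm,cn] d₁ k n)) (gcd-greatest (n∣m*n d₁) k∣d₁n)

-- A divisor of m n (m, n coprime, m n > 0) written as d₁ d₂ with d₁ ∣ m,
-- d₂ ∣ n; the factors are recorded as suc d₁, suc d₂ since they are positive.
record CoprimeSplit (m n k : ℕ) : Set where
  field
    d₁ d₂ : ℕ
    d₁∣m : suc d₁ ∣ m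
    d₂∣n : suc d₂ ∣ n
    k≡d₁d₂ : k ≡ suc d₁ *ℕ suc d₂

coprime-split : ∀ m n k → 0 < m *ℕ n → Coprime m n → k ∣ m *ℕ n → CoprimeSplit m n k
coprime-split m n k 0<mn m⊥n k∣mn with gcd k m | gcd k n | gcd[m,n]∣n k m | gcd[m,n]∣n k n | gcd-split k m n m⊥n k∣mn
... | suc d₁ | suc d₂ | d₁∣m | d₂∣n | k≡ = record { d₁ = d₁ ; d₂ = d₂ ; d₁∣m = d₁∣m ; d₂∣n = d₂∣n ; k≡d₁d₂ = k≡ }
... | zero | _ | _ | _ | ≡.refl = ⊥-elim (<-irrefl ≡.refl (divisor-pos 0<mn k∣mn))
... | suc d₁ | zero | _ | _ | k≡ = ⊥-elim (<-irrefl (≡.sym (≡.trans k≡ (*ℕ-zeroʳ (suc d₁)))) (divisor-pos 0<mn k∣mn))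

factor-eq : ∀ {e f d₁ d₂} → e ∣ suc d₁ → f ∣ suc d₂ → e *ℕ f ≡ suc d₁ *ℕ suc d₂ → e ≡ suc d₁
factor-eq {e} {f} {d₁} {d₂} e∣d₁ f∣d₂ ef≡ with e ≟ suc d₁
... | yes e≡d₁ = e≡d₁
... | no e≢d₁ = ⊥-elim (<-irrefl ef≡ (≤-<-trans (*-mono-≤ (≤-refl {e}) (∣⇒≤ f∣d₂)) (*-monoˡ-< (suc d₂) (≤∧≢⇒< (∣⇒≤ e∣d₁) e≢d₁))))

-- Arithmetical functions over an arbitrary commutative ring R; the inverses
-- inv only enter through the definitions of log and Ψ.
module ArithmeticalFunctions {c ℓ} (R : CommutativeRing c ℓ) (inv : ℕ → CommutativeRing.Carrier R) where
  open CommutativeRing R hiding (zero)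
  open Arith R inv
  open import Relation.Binary.Reasoning.Setoid setoid
  open import Algebra.Solver.Ring.NaturalCoefficients.Default commutativeSemiring using (solve; _:=_; _:+_; _:*_; con)
  open import Algebra.Properties.Ring ring using (-‿distribˡ-*; -‿distribʳ-*; x+x≈x⇒x≈0)
  open import Algebra.Properties.AbelianGroup +-abelianGroup using (⁻¹-∙-comm)
  open import Algebra.Properties.Group +-group using ()
    renaming (ε⁻¹≈ε to -0≈0; ⁻¹-involutive to -‿involutive; ∙-cancelʳ to +-cancelʳ)

  neg-+ : ∀ x y → - (x + y) ≈ - x + - y
  neg-+ x y = sym (⁻¹-∙-comm x y)

  sum-of-zeros : ∀ {x y} → x ≈ 0# → y ≈ 0# → x + y ≈ 0#
  sum-of-zeros x≈0 y≈0 = trans (+-cong x≈0 y≈0) (+-identityˡ 0#)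

  *-zero-right : ∀ {x y} → y ≈ 0# → x * y ≈ 0#
  *-zero-right {x} y≈0 = trans (*-congˡ y≈0) (zeroʳ x)

  *-zero-left : ∀ {x y} → x ≈ 0# → x * y ≈ 0#
  *-zero-left {y = y} x≈0 = trans (*-congʳ x≈0) (zeroˡ y)

  sub-add-cancel : ∀ A B C → (A - B) + (B + C) ≈ A + C
  sub-add-cancel A B C = begin
    (A - B) + (B + C) ≈⟨ solve 4 (λ A nB B C → (A :+ nB) :+ (B :+ C) := A :+ ((nB :+ B) :+ C)) refl A (- B) B C ⟩
    A + ((- B + B) + C) ≈⟨ +-congˡ (+-congʳ (-‿inverseˡ B)) ⟩
    A + (0# + C)        ≈⟨ +-congˡ (+-identityˡ C) ⟩
    A + C               ∎

  add-sub-cancel : ∀ A B → B + (A - B) ≈ A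
  add-sub-cancel A B = begin
    B + (A - B)   ≈⟨ solve 3 (λ B A nB → B :+ (A :+ nB) := A :+ (nB :+ B)) refl B A (- B) ⟩
    A + (- B + B) ≈⟨ +-congˡ (-‿inverseˡ B) ⟩
    A + 0#        ≈⟨ +-identityʳ A ⟩
    A             ∎

  natCast-+ : ∀ m n → natCast (m +ℕ n) ≈ natCast m + natCast n
  natCast-+ zero n = sym (+-identityˡ _)
  natCast-+ (suc m) n = trans (+-congˡ (natCast-+ m n)) (sym (+-assoc _ _ _))

  sum-cong : ∀ {f g : ℕ → Carrier} n → (∀ k → k < n → f (suc k) ≈ g (suc k)) → sum1 f n ≈ sum1 g n
  sum-cong zero _ = refl
  sum-cong (suc n) f≈g = +-cong (sum-cong n (λ k k<n → f≈g k (m≤n⇒m≤1+n k<n))) (f≈g n ≤-refl)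

  sum-zero : ∀ {f : ℕ → Carrier} n → (∀ k → k < n → f (suc k) ≈ 0#) → sum1 f n ≈ 0#
  sum-zero zero _ = refl
  sum-zero (suc n) f≈0 = sum-of-zeros (sum-zero n (λ k k<n → f≈0 k (m≤n⇒m≤1+n k<n))) (f≈0 n ≤-refl)

  sum-+ : ∀ (f g : ℕ → Carrier) n → sum1 (λ k → f k + g k) n ≈ sum1 f n + sum1 g n
  sum-+ f g zero = sym (+-identityˡ 0#)
  sum-+ f g (suc n) = trans (+-congʳ (sum-+ f g n))
    (solve 4 (λ a b x y → (a :+ b) :+ (x :+ y) := ((a :+ x) :+ (b :+ y))) refl _ _ _ _)

  sum-*ˡ : ∀ x (f : ℕ → Carrier) n → x * sum1 f n ≈ sum1 (λ k → x * f k) n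
  sum-*ˡ x f zero = zeroʳ x
  sum-*ˡ x f (suc n) = trans (distribˡ x _ _) (+-congʳ (sum-*ˡ x f n))

  sum-*ʳ : ∀ y (f : ℕ → Carrier) n → sum1 f n * y ≈ sum1 (λ k → f k * y) n
  sum-*ʳ y f n = trans (*-comm _ y) (trans (sum-*ˡ y f n) (sum-cong n (λ k _ → *-comm y (f (suc k)))))

  sum-neg : ∀ (f : ℕ → Carrier) n → - sum1 f n ≈ sum1 (λ k → - f k) n
  sum-neg f zero = -0≈0
  sum-neg f (suc n) = trans (neg-+ _ _) (+-congʳ (sum-neg f n))

  sum-extend : ∀ {f : ℕ → Carrier} n m → n ≤ m → (∀ k → n ≤ k → k < m → f (suc k) ≈ 0#) → sum1 f m ≈ sum1 f n
  sum-extend n zero z≤n _ = refl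
  sum-extend n (suc m) n≤1+m f≈0 with n ≟ suc m
  ... | yes ≡.refl = refl
  ... | no n≢1+m = trans (+-cong (sum-extend n m n≤m (λ k n≤k k<m → f≈0 k n≤k (m≤n⇒m≤1+n k<m))) (f≈0 m n≤m ≤-refl))
                         (+-identityʳ _)
    where
      n≤m : n ≤ m
      n≤m = ≤-pred (≤∧≢⇒< n≤1+m n≢1+m)

  sum-single : ∀ {f : ℕ → Carrier} n j → j < n → (∀ k → k < n → k ≢ j → f (suc k) ≈ 0#) → sum1 f n ≈ f (suc j)
  sum-single (suc n) j j<1+n f≈0 with j ≟ n
  ... | yes ≡.refl = trans (+-congʳ (sum-zero n (λ k k<n → f≈0 k (m≤n⇒m≤1+n k<n) (λ { ≡.refl → <-irrefl ≡.refl k<n }))))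
                           (+-identityˡ _)
  ... | no j≢n = trans (+-cong (sum-single n j (≤∧≢⇒< (≤-pred j<1+n) j≢n) (λ k k<n → f≈0 k (m≤n⇒m≤1+n k<n)))
                               (f≈0 n ≤-refl (λ n≡j → j≢n (≡.sym n≡j))))
                       (+-identityʳ _)

  sum-swap : ∀ (f : ℕ → ℕ → Carrier) m n → sum1 (λ i → sum1 (λ j → f i j) n) m ≈ sum1 (λ j → sum1 (λ i → f i j) m) n
  sum-swap f zero n = sym (sum-zero n (λ _ _ → refl))
  sum-swap f (suc m) n = trans (+-congʳ (sum-swap f m n)) (sym (sum-+ _ _ n))

  sum-shift : ∀ (T : ℕ → Carrier) M → sum1 (λ k → T (k ∸ 1)) (suc M) ≈ T 0 + sum1 T M
  sum-shift T zero = trans (+-identityˡ _) (sym (+-identityʳ _))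
  sum-shift T (suc M) = trans (+-congʳ (sum-shift T M)) (+-assoc _ _ _)

  S : ℕ → (ℕ → Carrier) → Carrier
  S N f = sum1 f N

  sum-sink₃ : ∀ (g : ℕ → ℕ → ℕ → Carrier) N →
    S N (λ x → S N (λ y → S N (λ z → g x y z))) ≈ S N (λ y → S N (λ z → S N (λ x → g x y z)))
  sum-sink₃ g N = trans (sum-swap (λ x y → S N (λ z → g x y z)) N N)
                        (sum-cong N (λ y _ → sum-swap (λ x z → g x (suc y) z) N N))

  sum-sink₄ : ∀ (g : ℕ → ℕ → ℕ → ℕ → Carrier) N →
    S N (λ w → S N (λ x → S N (λ y → S N (λ z → g w x y z)))) ≈ S N (λ x → S N (λ y → S N (λ z → S N (λ w → g w x y z))))
  sum-sink₄ g N = trans (sum-swap (λ w x → S N (λ y → S N (λ z → g w x y z))) N N)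
                        (sum-cong N (λ x _ → sum-sink₃ (λ w y z → g w (suc x) y z) N))

  dirTerm-∣ : ∀ a b n k → suc k ∣ n → dirTerm a b n (suc k) ≈ a (suc k) * b (n / suc k)
  dirTerm-∣ a b n k k∣n with suc k ∣? n
  ... | yes _ = refl
  ... | no k∤n = ⊥-elim (k∤n k∣n)

  dirTerm-∤ : ∀ a b n k → ¬ suc k ∣ n → dirTerm a b n (suc k) ≈ 0#
  dirTerm-∤ a b n k k∤n with suc k ∣? n
  ... | yes k∣n = ⊥-elim (k∤n k∣n)
  ... | no _ = refl

  dirTerm-lift : ∀ a b a' b' a'' b'' n (F : Carrier → Carrier → Carrier) → F 0# 0# ≈ 0# →
    ∀ k → (suc k ∣ n → a (suc k) * b (n / suc k) ≈ F (a' (suc k) * b' (n / suc k)) (a'' (suc k) * b'' (n / suc k))) →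
    dirTerm a b n (suc k) ≈ F (dirTerm a' b' n (suc k)) (dirTerm a'' b'' n (suc k))
  dirTerm-lift a b a' b' a'' b'' n F F00 k commutes with suc k ∣? n
  ... | yes k∣n = commutes k∣n
  ... | no _ = sym F00

  dirTerm-local : ∀ a a' b b' n k → (suc k ∣ n → a (suc k) ≈ a' (suc k)) → (suc k ∣ n → b (n / suc k) ≈ b' (n / suc k)) →
    dirTerm a b n (suc k) ≈ dirTerm a' b' n (suc k)
  dirTerm-local a a' b b' n k a≈ b≈ with suc k ∣? n
  ... | yes k∣n = *-cong (a≈ k∣n) (b≈ k∣n)
  ... | no _ = refl

  star-local : ∀ a a' b b' n → (∀ d → d ∣ n → a d ≈ a' d) → (∀ d → d ∣ n → b d ≈ b' d) → (a ⋆ b) n ≈ (a' ⋆ b') n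
  star-local a a' b b' n a≈ b≈ =
    sum-cong n (λ k _ → dirTerm-local a a' b b' n k (a≈ (suc k)) (λ k∣n → b≈ (n / suc k) (m/n∣m k∣n)))

  star-cong : ∀ {a a' b b'} → a ≃ a' → b ≃ b' → (a ⋆ b) ≃ (a' ⋆ b')
  star-cong {a} {a'} {b} {b'} a≃ b≃ n 0<n =
    star-local a a' b b' n (λ d d∣n → a≃ d (divisor-pos 0<n d∣n)) (λ d d∣n → b≃ d (divisor-pos 0<n d∣n))

  star-last : ∀ a b n → (a ⋆ b) (suc n) ≈ sum1 (dirTerm a b (suc n)) n + a (suc n) * b 1
  star-last a b n = +-congˡ (trans (dirTerm-∣ a b (suc n) n ∣-refl) (*-congˡ (reflexive (≡.cong b (n/n≡1 (suc n))))))

  star-proper-local : ∀ a a' b b' n → (∀ d → d ∣ suc n → d < suc n → a d ≈ a' d) → (∀ d → d ∣ suc n → b d ≈ b' d) →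
    sum1 (dirTerm a b (suc n)) n ≈ sum1 (dirTerm a' b' (suc n)) n
  star-proper-local a a' b b' n a≈ b≈ =
    sum-cong n (λ k k<n → dirTerm-local a a' b b' (suc n) k (λ k∣n → a≈ (suc k) k∣n (s≤s k<n)) (λ k∣n → b≈ _ (m/n∣m k∣n)))

  -- Kronecker delta on ℕ, kept abstract so that only δ-≡ and δ-≢ are used.
  abstract
    δ : ℕ → ℕ → Carrier
    δ i j with i ≟ j
    ... | yes _ = 1#
    ... | no _ = 0#

    δ-≡ : ∀ {i j} → i ≡ j → δ i j ≈ 1#
    δ-≡ {i} {j} i≡j with i ≟ j
    ... | yes _ = refl
    ... | no i≢j = ⊥-elim (i≢j i≡j)

    δ-≢ : ∀ {i j} → i ≢ j → δ i j ≈ 0#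
    δ-≢ {i} {j} i≢j with i ≟ j
    ... | yes i≡j = ⊥-elim (i≢j i≡j)
    ... | no _ = refl

  δ-cong : ∀ {i i' j} → i ≡ i' → δ i j ≈ δ i' j
  δ-cong ≡.refl = refl

  δ-≡-* : ∀ {i j} y → i ≡ j → δ i j * y ≈ y
  δ-≡-* y i≡j = trans (*-congʳ (δ-≡ i≡j)) (*-identityˡ y)

  δ-≢-* : ∀ {i j} y → i ≢ j → δ i j * y ≈ 0#
  δ-≢-* y i≢j = *-zero-left (δ-≢ i≢j)

  δ-guard : ∀ i j {x y} → (i ≡ j → x ≈ y) → δ i j * x ≈ δ i j * y
  δ-guard i j {x} {y} x≈y with i ≟ j
  ... | yes i≡j = *-congˡ (x≈y i≡j)
  ... | no i≢j = trans (δ-≢-* x i≢j) (sym (δ-≢-* y i≢j))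

  δ-sum-in : ∀ (g : ℕ → Carrier) x N → 0 < x → x ≤ N → S N (λ m → δ x m * g m) ≈ g x
  δ-sum-in g (suc x) N _ x≤N = trans (sum-single N x x≤N (λ k _ k≢x → δ-≢-* _ (λ x≡k → k≢x (≡.sym (suc-injective x≡k)))))
                                     (δ-≡-* (g (suc x)) ≡.refl)

  δ-sum-out : ∀ (g : ℕ → Carrier) x N → N < x → S N (λ m → δ x m * g m) ≈ 0#
  δ-sum-out g x N N<x = sum-zero N (λ k k<N → δ-≢-* _ (λ { ≡.refl → <-irrefl ≡.refl (≤-trans N<x k<N) }))

  -- Summing δ(x,m) δ(h m, n) A over m substitutes m := x, provided x ≤ h x
  -- (so that if x exceeds the range, δ(h x, n) vanishes as well).
  δ-collapse : ∀ x (h : ℕ → ℕ) n (A : Carrier) → 0 < x → x ≤ h x → S n (λ m → δ x m * (δ (h m) n * A)) ≈ δ (h x) n * A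
  δ-collapse x h n A 0<x x≤hx with x ≤? n
  ... | yes x≤n = δ-sum-in (λ m → δ (h m) n * A) x n 0<x x≤n
  ... | no x≰n = trans (δ-sum-out _ x n (≰⇒> x≰n)) (sym (δ-≢-* A (λ hx≡n → x≰n (≤-trans x≤hx (≤-reflexive hx≡n)))))

  box : AF → AF → ℕ → ℕ → Carrier
  box a b n N = S N (λ d → S N (λ e → δ (d *ℕ e) n * (a d * b e)))

  dirTerm-box : ∀ a b n N k → 0 < n → n ≤ N → dirTerm a b n (suc k) ≈ S N (λ e → δ (suc k *ℕ e) n * (a (suc k) * b e))
  dirTerm-box a b n N k 0<n n≤N with suc k ∣? n
  ... | no k∤n = sym (sum-zero N (λ i _ → δ-≢-* _ (λ ki≡n → k∤n (divides (suc i) (≡.trans (≡.sym ki≡n) (*ℕ-comm (suc k) (suc i)))))))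
  ... | yes k∣n with n / suc k in n/k≡ | m*[n/m]≡n k∣n
  ...   | zero | k*0≡n = ⊥-elim (<⇒≢ 0<n (≡.trans (≡.sym (*ℕ-zeroʳ (suc k))) k*0≡n))
  ...   | suc j | kj≡n = sym (trans (sum-single N j j<N others) (δ-≡-* _ kj≡n))
    where
    j<N : suc j ≤ N
    j<N = ≤-trans (≡.subst (_≤ n) n/k≡ (m/n≤m n (suc k))) n≤N
    others : ∀ i → i < N → i ≢ j → δ (suc k *ℕ suc i) n * (a (suc k) * b (suc i)) ≈ 0#
    others i _ i≢j = δ-≢-* _ (λ ki≡n → i≢j (suc-injective (*-cancelˡ-≡ (suc i) (suc j) (suc k) (≡.trans ki≡n (≡.sym kj≡n)))))

  -- Divisor pairs beyond n contribute nothing, so any bound N ≥ n may be used.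
  star-box : ∀ a b n N → 0 < n → n ≤ N → (a ⋆ b) n ≈ box a b n N
  star-box a b n N 0<n n≤N = trans (sum-cong n (λ k _ → dirTerm-box a b n N k 0<n n≤N))
    (sym (sum-extend n N n≤N (λ k n≤k _ → sum-zero N (λ i _ → δ-≢-* _ (too-big k i n≤k)))))
    where
    too-big : ∀ k i → n ≤ k → suc k *ℕ suc i ≢ n
    too-big k i n≤k ki≡n = <-irrefl ≡.refl (≤-trans (s≤s n≤k) (≡.subst (suc k ≤_) ki≡n (m≤m*n (suc k) (suc i))))

  -- Commutativity: the box form is symmetric under swapping d and e.
  star-comm : ∀ a b n → 0 < n → (a ⋆ b) n ≈ (b ⋆ a) n
  star-comm a b n 0<n = begin
    (a ⋆ b) n ≈⟨ star-box a b n n 0<n ≤-refl ⟩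
    box a b n n ≈⟨ sum-swap (λ d e → δ (d *ℕ e) n * (a d * b e)) n n ⟩
    S n (λ e → S n (λ d → δ (d *ℕ e) n * (a d * b e)))
      ≈⟨ sum-cong n (λ e _ → sum-cong n (λ d _ → *-cong (δ-cong (*ℕ-comm (suc d) (suc e))) (*-comm _ _))) ⟩
    box b a n n ≈⟨ sym (star-box b a n n 0<n ≤-refl) ⟩
    (b ⋆ a) n ∎

  double-sum-* : ∀ x y (g : ℕ → ℕ → Carrier) N → x * (S N (λ d → S N (λ e → g d e)) * y) ≈ S N (λ d → S N (λ e → x * (g d e * y)))
  double-sum-* x y g N = begin
    x * (S N (λ d → S N (λ e → g d e)) * y) ≈⟨ *-congˡ (sum-*ʳ y _ N) ⟩
    x * S N (λ d → S N (λ e → g d e) * y)   ≈⟨ sum-*ˡ x _ N ⟩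
    S N (λ d → x * (S N (λ e → g d e) * y)) ≈⟨ sum-cong N (λ d _ → trans (*-congˡ (sum-*ʳ y _ N)) (sum-*ˡ x _ N)) ⟩
    S N (λ d → S N (λ e → x * (g d e * y))) ∎

  triple : AF → AF → AF → ℕ → Carrier
  triple a b c n = S n (λ d → S n (λ e → S n (λ f → δ (d *ℕ e *ℕ f) n * ((a d * b e) * c f))))

  star-triple-left : ∀ a b c n → 0 < n → ((a ⋆ b) ⋆ c) n ≈ triple a b c n
  star-triple-left a b c n 0<n = begin
    ((a ⋆ b) ⋆ c) n ≈⟨ star-box (a ⋆ b) c n n 0<n ≤-refl ⟩
    S n (λ m → S n (λ f → δ (m *ℕ f) n * ((a ⋆ b) m * c f)))
      ≈⟨ sum-cong n (λ m _ → sum-cong n (λ f _ → expand m f)) ⟩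
    S n (λ m → S n (λ f → S n (λ d → S n (λ e → T m f d e)))) ≈⟨ sum-sink₄ T n ⟩
    S n (λ f → S n (λ d → S n (λ e → S n (λ m → T m f d e)))) ≈⟨ sum-sink₃ (λ f d e → S n (λ m → T m f d e)) n ⟩
    S n (λ d → S n (λ e → S n (λ f → S n (λ m → T m f d e))))
      ≈⟨ sum-cong n (λ d _ → sum-cong n (λ e _ → sum-cong n (λ f _ → collapse d e f))) ⟩
    triple a b c n ∎
    where
    T : ℕ → ℕ → ℕ → ℕ → Carrier
    T m f d e = δ (m *ℕ f) n * ((δ (d *ℕ e) m * (a d * b e)) * c f)
    expand : ∀ m f → δ (suc m *ℕ suc f) n * ((a ⋆ b) (suc m) * c (suc f)) ≈ S n (λ d → S n (λ e → T (suc m) (suc f) d e))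
    expand m f = trans
      (δ-guard (suc m *ℕ suc f) n (λ mf≡n → *-congʳ (star-box a b (suc m) n (s≤s z≤n) (≤-trans (m≤m*n (suc m) (suc f)) (≤-reflexive mf≡n)))))
      (double-sum-* _ _ _ n)
    collapse : ∀ d e f → S n (λ m → T m (suc f) (suc d) (suc e)) ≈ δ (suc d *ℕ suc e *ℕ suc f) n * ((a (suc d) * b (suc e)) * c (suc f))
    collapse d e f = trans (sum-cong n (λ m _ → solve 4 (λ p q A C → p :* ((q :* A) :* C) := q :* (p :* (A :* C))) refl _ _ _ _))
      (δ-collapse (suc d *ℕ suc e) (λ m → m *ℕ suc f) n _ (s≤s z≤n) (m≤m*n _ (suc f)))

  star-triple-right : ∀ a b c n → 0 < n → (a ⋆ (b ⋆ c)) n ≈ triple a b c n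
  star-triple-right a b c n 0<n = begin
    (a ⋆ (b ⋆ c)) n ≈⟨ star-box a (b ⋆ c) n n 0<n ≤-refl ⟩
    S n (λ d → S n (λ g → δ (d *ℕ g) n * (a d * (b ⋆ c) g)))
      ≈⟨ sum-cong n (λ d _ → sum-cong n (λ g _ → expand d g)) ⟩
    S n (λ d → S n (λ g → S n (λ e → S n (λ f → T d g e f))))
      ≈⟨ sum-cong n (λ d _ → sum-sink₃ (λ g e f → T (suc d) g e f) n) ⟩
    S n (λ d → S n (λ e → S n (λ f → S n (λ g → T d g e f))))
      ≈⟨ sum-cong n (λ d _ → sum-cong n (λ e _ → sum-cong n (λ f _ → collapse d e f))) ⟩
    triple a b c n ∎
    where
    T : ℕ → ℕ → ℕ → ℕ → Carrier
    T d g e f = δ (d *ℕ g) n * (a d * (δ (e *ℕ f) g * (b e * c f)))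
    expand : ∀ d g → δ (suc d *ℕ suc g) n * (a (suc d) * (b ⋆ c) (suc g)) ≈ S n (λ e → S n (λ f → T (suc d) (suc g) e f))
    expand d g = begin
      δ (suc d *ℕ suc g) n * (a (suc d) * (b ⋆ c) (suc g))
        ≈⟨ δ-guard (suc d *ℕ suc g) n (λ dg≡n → *-congˡ (star-box b c (suc g) n (s≤s z≤n)
             (≤-trans (m≤n*m (suc g) (suc d)) (≤-reflexive dg≡n)))) ⟩
      δ (suc d *ℕ suc g) n * (a (suc d) * box b c (suc g) n)
        ≈⟨ *-congˡ (trans (sum-*ˡ (a (suc d)) _ n) (sum-cong n (λ e _ → sum-*ˡ (a (suc d)) _ n))) ⟩
      δ (suc d *ℕ suc g) n * S n (λ e → S n (λ f → a (suc d) * (δ (e *ℕ f) (suc g) * (b e * c f))))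
        ≈⟨ trans (sum-*ˡ _ _ n) (sum-cong n (λ e _ → sum-*ˡ _ _ n)) ⟩
      S n (λ e → S n (λ f → T (suc d) (suc g) e f)) ∎
    collapse : ∀ d e f → S n (λ g → T (suc d) g (suc e) (suc f)) ≈ δ (suc d *ℕ suc e *ℕ suc f) n * ((a (suc d) * b (suc e)) * c (suc f))
    collapse d e f = begin
      S n (λ g → T (suc d) g (suc e) (suc f))
        ≈⟨ sum-cong n (λ _ _ → solve 4 (λ p A q B → p :* (A :* (q :* B)) := q :* (p :* (A :* B))) refl _ _ _ _) ⟩
      S n (λ g → δ (suc e *ℕ suc f) g * (δ (suc d *ℕ g) n * (a (suc d) * (b (suc e) * c (suc f)))))
        ≈⟨ δ-collapse (suc e *ℕ suc f) (λ g → suc d *ℕ g) n _ (s≤s z≤n) (m≤n*m _ (suc d)) ⟩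
      δ (suc d *ℕ (suc e *ℕ suc f)) n * (a (suc d) * (b (suc e) * c (suc f)))
        ≈⟨ sym (*-cong (δ-cong (*ℕ-assoc (suc d) (suc e) (suc f))) (*-assoc _ _ _)) ⟩
      δ (suc d *ℕ suc e *ℕ suc f) n * ((a (suc d) * b (suc e)) * c (suc f)) ∎

  star-assoc : ∀ a b c n → 0 < n → ((a ⋆ b) ⋆ c) n ≈ (a ⋆ (b ⋆ c)) n
  star-assoc a b c n 0<n = trans (star-triple-left a b c n 0<n) (sym (star-triple-right a b c n 0<n))

  scale : Carrier → AF → AF
  scale x a n = x * a n

  negate : AF → AF
  negate a n = - a n

  zeroF : AF
  zeroF _ = 0#

  star-+ʳ : ∀ a b c n → (a ⋆ (b ⊕ c)) n ≈ (a ⋆ b) n + (a ⋆ c) n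
  star-+ʳ a b c n = trans (sum-cong n (λ k _ → dirTerm-lift a (b ⊕ c) a b a c n _+_ (+-identityˡ 0#) k (λ _ → distribˡ _ _ _)))
                          (sum-+ _ _ n)

  star-+ˡ : ∀ a b c n → ((a ⊕ b) ⋆ c) n ≈ (a ⋆ c) n + (b ⋆ c) n
  star-+ˡ a b c n = trans (sum-cong n (λ k _ → dirTerm-lift (a ⊕ b) c a c b c n _+_ (+-identityˡ 0#) k (λ _ → distribʳ _ _ _)))
                          (sum-+ _ _ n)

  star-negʳ : ∀ a b n → (a ⋆ negate b) n ≈ - (a ⋆ b) n
  star-negʳ a b n = trans (sum-cong n (λ k _ → dirTerm-lift a (negate b) a b a b n (λ x _ → - x) -0≈0 k (λ _ → sym (-‿distribʳ-* _ _))))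
                          (sym (sum-neg _ n))

  star-negˡ : ∀ a b n → (negate a ⋆ b) n ≈ - (a ⋆ b) n
  star-negˡ a b n = trans (sum-cong n (λ k _ → dirTerm-lift (negate a) b a b a b n (λ x _ → - x) -0≈0 k (λ _ → sym (-‿distribˡ-* _ _))))
                          (sym (sum-neg _ n))

  star-scaleˡ : ∀ x a b n → (scale x a ⋆ b) n ≈ x * (a ⋆ b) n
  star-scaleˡ x a b n = trans (sum-cong n (λ k _ → dirTerm-lift (scale x a) b a b a b n (λ y _ → x * y) (zeroʳ x) k (λ _ → *-assoc _ _ _)))
                              (sym (sum-*ˡ x _ n))

  star-scaleʳ : ∀ x a b n → (a ⋆ scale x b) n ≈ x * (a ⋆ b) n
  star-scaleʳ x a b n = trans (sum-cong n (λ k _ → dirTerm-lift a (scale x b) a b a b n (λ y _ → x * y) (zeroʳ x) k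
                                 (λ _ → solve 3 (λ x p q → p :* (x :* q) := x :* (p :* q)) refl _ _ _)))
                              (sym (sum-*ˡ x _ n))

  star-zeroˡ : ∀ a n → (zeroF ⋆ a) n ≈ 0#
  star-zeroˡ a n = sum-zero n (λ k _ → dirTerm-lift zeroF a zeroF a zeroF a n (λ _ _ → 0#) refl k (λ _ → zeroˡ _))

  star-zeroʳ : ∀ a n → (a ⋆ zeroF) n ≈ 0#
  star-zeroʳ a n = sum-zero n (λ k _ → dirTerm-lift a zeroF a zeroF a zeroF n (λ _ _ → 0#) refl k (λ _ → zeroʳ _))

  star-sumˡ : ∀ (F : ℕ → AF) b N n → ((λ m → sum1 (λ k → F k m) N) ⋆ b) n ≈ sum1 (λ k → (F k ⋆ b) n) N
  star-sumˡ F b zero n = star-zeroˡ b n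
  star-sumˡ F b (suc N) n = trans (star-+ˡ (λ m → sum1 (λ k → F k m) N) (F (suc N)) b n) (+-congʳ (star-sumˡ F b N n))

  I-≢1 : ∀ q → q ≢ 1 → I q ≈ 0#
  I-≢1 zero _ = refl
  I-≢1 (suc zero) q≢1 = ⊥-elim (q≢1 ≡.refl)
  I-≢1 (suc (suc q)) _ = refl

  star-Iʳ : ∀ a n → 0 < n → (a ⋆ I) n ≈ a n
  star-Iʳ a (suc n) _ = trans (star-last a I n) (trans (+-cong (sum-zero n proper-vanish) (*-identityʳ _)) (+-identityˡ _))
    where
    cofactor≢1 : ∀ k → k < n → suc k ∣ suc n → suc n / suc k ≢ 1
    cofactor≢1 k k<n k∣n q≡1 = <-irrefl ≡.refl (≤-trans (s≤s k<n) (≤-reflexive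
      (≡.trans (≡.sym (≡.trans (≡.cong (suc k *ℕ_) (≡.sym q≡1)) (m*[n/m]≡n k∣n))) (*ℕ-identityʳ (suc k)))))
    proper-vanish : ∀ k → k < n → dirTerm a I (suc n) (suc k) ≈ 0#
    proper-vanish k k<n = dirTerm-lift a I a I a I (suc n) (λ _ _ → 0#) refl k
      (λ k∣n → *-zero-right (I-≢1 _ (cofactor≢1 k k<n k∣n)))

  star-Iˡ : ∀ a n → 0 < n → (I ⋆ a) n ≈ a n
  star-Iˡ a n 0<n = trans (star-comm I a n 0<n) (star-Iʳ a n 0<n)

  pow-cong : ∀ {a b} → a ≃ b → ∀ k → pow a k ≃ pow b k
  pow-cong a≃b zero n _ = refl
  pow-cong a≃b (suc k) = star-cong a≃b (pow-cong a≃b k)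

  pow-local : ∀ x y N → (∀ d → d ∣ N → x d ≈ y d) → ∀ k d → d ∣ N → pow x k d ≈ pow y k d
  pow-local x y N x≈y zero d _ = refl
  pow-local x y N x≈y (suc k) d d∣N =
    star-local x y (pow x k) (pow y k) d (λ e e∣d → x≈y e (∣-trans e∣d d∣N)) (λ e e∣d → pow-local x y N x≈y k e (∣-trans e∣d d∣N))

  -- Nilpotency: for x ∈ 𝕄, x^{⋆(k+1)}(m) = 0 whenever 1 ≤ m ≤ k+1.  In
  -- (x ⋆ x^{⋆k})(m) the summand at d = 1 vanishes as x(1) = 0, and the others
  -- by induction since then m/d < m.
  pow-nil : ∀ x → x 1 ≈ 0# → ∀ k m → 0 < m → m ≤ suc k → pow x (suc k) m ≈ 0#
  pow-nil x x1≈0 zero (suc zero) _ _ = trans (star-Iʳ x 1 (s≤s z≤n)) x1≈0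
  pow-nil x x1≈0 zero (suc (suc m)) _ (s≤s ())
  pow-nil x x1≈0 (suc k) (suc m) _ m≤k+2 = sum-zero (suc m) vanish
    where
    vanish : ∀ j → j < suc m → dirTerm x (pow x (suc k)) (suc m) (suc j) ≈ 0#
    vanish zero _ = dirTerm-lift x (pow x (suc k)) x x x x (suc m) (λ _ _ → 0#) refl zero (λ _ → *-zero-left x1≈0)
    vanish (suc j) _ = dirTerm-lift x (pow x (suc k)) x x x x (suc m) (λ _ _ → 0#) refl (suc j)
      (λ j∣m → *-zero-right (pow-nil x x1≈0 k _ (cofactor-pos (suc j) (suc m) (s≤s z≤n) j∣m)
         (≤-pred (≤-trans (m/n<m (suc m) (suc (suc j)) (s≤s (s≤s z≤n))) m≤k+2))))

  pow-nil-star : ∀ x → x 1 ≈ 0# → ∀ N b n → 0 < n → n ≤ suc N → (pow x (suc N) ⋆ b) n ≈ 0#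
  pow-nil-star x x1≈0 N b n 0<n n≤N+1 = trans
    (star-local (pow x (suc N)) zeroF b b n
      (λ d d∣n → pow-nil x x1≈0 N d (divisor-pos 0<n d∣n) (≤-trans (∣⇒≤ {{>-nonZero 0<n}} d∣n) n≤N+1)) (λ _ _ → refl))
    (star-zeroˡ b n)

  -- The derivation D a (n) = Ω(n) a(n).  Since Ω is completely additive,
  -- D satisfies the Leibniz rule for ⋆.

  D : AF → AF
  D a n = natCast (Ω n) * a n

  D-leibniz : ∀ a b n → 0 < n → D (a ⋆ b) n ≈ (D a ⋆ b) n + (a ⋆ D b) n
  D-leibniz a b n 0<n = trans (sum-*ˡ _ _ n) (trans (sum-cong n summand) (sum-+ _ _ n))
    where
    summand : ∀ k → k < n → natCast (Ω n) * dirTerm a b n (suc k) ≈ dirTerm (D a) b n (suc k) + dirTerm a (D b) n (suc k)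
    summand k _ with suc k ∣? n
    ... | no _ = trans (zeroʳ _) (sym (+-identityˡ 0#))
    ... | yes k∣n = begin
      natCast (Ω n) * (a (suc k) * b q)
        ≈⟨ *-congʳ (reflexive (≡.cong (λ z → natCast (Ω z)) (≡.sym (m*[n/m]≡n k∣n)))) ⟩
      natCast (Ω (suc k *ℕ q)) * (a (suc k) * b q)
        ≈⟨ *-congʳ (trans (reflexive (≡.cong natCast (Ω-* (suc k) q (s≤s z≤n) (cofactor-pos k n 0<n k∣n))))
                          (natCast-+ (Ω (suc k)) (Ω q))) ⟩
      (natCast (Ω (suc k)) + natCast (Ω q)) * (a (suc k) * b q)
        ≈⟨ solve 4 (λ x y A B → (x :+ y) :* (A :* B) := ((x :* A) :* B :+ A :* (y :* B))) refl _ _ _ _ ⟩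
      D a (suc k) * b q + a (suc k) * D b q ∎
      where
        q : ℕ
        q = n / suc k

  D-I : ∀ n → D I n ≈ 0#
  D-I zero = zeroʳ _
  D-I (suc zero) = zeroˡ _
  D-I (suc (suc n)) = zeroʳ _

  D-⊕ : ∀ a b n → D (a ⊕ b) n ≈ D a n + D b n
  D-⊕ a b n = distribˡ _ _ _

  D-⊖ : ∀ a b n → D (a ⊖ b) n ≈ D a n - D b n
  D-⊖ a b n = trans (distribˡ _ _ _) (+-congˡ (sym (-‿distribʳ-* _ _)))

  D-pow : ∀ x k n → 0 < n → D (pow x (suc k)) n ≈ natCast (suc k) * (pow x k ⋆ D x) n
  D-pow x zero n 0<n = begin
    D (x ⋆ I) n ≈⟨ D-leibniz x I n 0<n ⟩
    (D x ⋆ I) n + (x ⋆ D I) n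
      ≈⟨ +-cong (star-Iʳ (D x) n 0<n) (trans (star-local x x (D I) zeroF n (λ _ _ → refl) (λ d _ → D-I d)) (star-zeroʳ x n)) ⟩
    D x n + 0#          ≈⟨ solve 1 (λ y → y :+ con 0 := (con 1 :+ con 0) :* y) refl _ ⟩
    (1# + 0#) * D x n   ≈⟨ *-congˡ (sym (star-Iˡ (D x) n 0<n)) ⟩
    natCast 1 * (I ⋆ D x) n ∎
  D-pow x (suc k) n 0<n = begin
    D (x ⋆ P) n ≈⟨ D-leibniz x P n 0<n ⟩
    (D x ⋆ P) n + (x ⋆ D P) n
      ≈⟨ +-cong (star-comm (D x) P n 0<n)
                (star-local x x (D P) (scale k+1 (pow x k ⋆ D x)) n (λ _ _ → refl) (λ d d∣n → D-pow x k d (divisor-pos 0<n d∣n))) ⟩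
    (P ⋆ D x) n + (x ⋆ scale k+1 (pow x k ⋆ D x)) n ≈⟨ +-congˡ (star-scaleʳ k+1 x _ n) ⟩
    (P ⋆ D x) n + k+1 * (x ⋆ (pow x k ⋆ D x)) n     ≈⟨ +-congˡ (*-congˡ (sym (star-assoc x (pow x k) (D x) n 0<n))) ⟩
    (P ⋆ D x) n + k+1 * (P ⋆ D x) n                 ≈⟨ solve 2 (λ c y → y :+ c :* y := (con 1 :+ c) :* y) refl _ _ ⟩
    (1# + k+1) * (P ⋆ D x) n ∎
    where
    P : AF
    P = pow x (suc k)
    k+1 : Carrier
    k+1 = natCast (suc k)

  negPow-cong : ∀ j {x y} → x ≈ y → negPow j x ≈ negPow j y
  negPow-cong zero x≈y = x≈y
  negPow-cong (suc j) x≈y = -‿cong (negPow-cong j x≈y)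

  negPow-*ˡ : ∀ j x y → negPow j x * y ≈ negPow j (x * y)
  negPow-*ˡ zero x y = refl
  negPow-*ˡ (suc j) x y = trans (sym (-‿distribˡ-* _ _)) (-‿cong (negPow-*ˡ j x y))

  negPow-+ : ∀ j x y → negPow j (x + y) ≈ negPow j x + negPow j y
  negPow-+ zero x y = refl
  negPow-+ (suc j) x y = trans (-‿cong (negPow-+ j x y)) (neg-+ _ _)

  negPow-0 : ∀ j → negPow j 0# ≈ 0#
  negPow-0 zero = refl
  negPow-0 (suc j) = trans (-‿cong (negPow-0 j)) -0≈0

  signed : ℕ → AF → AF
  signed j a m = negPow j (a m)

  star-signedˡ : ∀ j a b n → (signed j a ⋆ b) n ≈ negPow j ((a ⋆ b) n)
  star-signedˡ zero a b n = refl
  star-signedˡ (suc j) a b n = trans (star-negˡ (signed j a) b n) (-‿cong (star-signedˡ j a b n))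

  star-signedʳ : ∀ j a b n → (a ⋆ signed j b) n ≈ negPow j ((a ⋆ b) n)
  star-signedʳ zero a b n = refl
  star-signedʳ (suc j) a b n = trans (star-negʳ a (signed j b) n) (-‿cong (star-signedʳ j a b n))

  series : (ℕ → Carrier) → AF → ℕ → AF
  series cf y N m = sum1 (λ k → cf k * pow y k m) N

  series-trunc : ∀ y → y 1 ≈ 0# → ∀ cf m N → 0 < m → m ≤ N → series cf y N m ≈ series cf y m m
  series-trunc y y1≈0 cf m N 0<m m≤N =
    sum-extend m N m≤N (λ k m≤k _ → *-zero-right (pow-nil y y1≈0 k m 0<m (m≤n⇒m≤1+n m≤k)))

  D-series : ∀ cf y N n → 0 < n → D (series cf y N) n ≈ sum1 (λ k → cf k * (natCast k * (pow y (k ∸ 1) ⋆ D y) n)) N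
  D-series cf y N n 0<n = trans (sum-*ˡ _ _ N) (sum-cong N term)
    where
    term : ∀ k → k < N → natCast (Ω n) * (cf (suc k) * pow y (suc k) n) ≈ cf (suc k) * (natCast (suc k) * (pow y k ⋆ D y) n)
    term k _ = trans (solve 3 (λ a b x → a :* (b :* x) := b :* (a :* x)) refl _ _ _) (*-congˡ (D-pow y k n 0<n))

  geometric : AF → ℕ → AF
  geometric y N m = sum1 (λ k → negPow (k ∸ 1) (pow y (k ∸ 1) m)) N

  telescope : ∀ a N n → 0 < n → (a ⋆ geometric (a ⊖ I) N) n ≈ I n - negPow N (pow (a ⊖ I) N n)
  telescope a zero n 0<n = trans (star-zeroʳ a n) (sym (-‿inverseʳ (I n)))
  telescope a (suc N) n 0<n = begin
    (a ⋆ geometric x (suc N)) n ≈⟨ star-+ʳ a (geometric x N) (signed N (pow x N)) n ⟩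
    (a ⋆ geometric x N) n + (a ⋆ signed N (pow x N)) n ≈⟨ +-cong (telescope a N n 0<n) (star-signedʳ N a (pow x N) n) ⟩
    (I n - negPow N X) + negPow N ((a ⋆ pow x N) n) ≈⟨ +-congˡ (negPow-cong N a⋆X) ⟩
    (I n - negPow N X) + negPow N (X + Y)           ≈⟨ +-congˡ (negPow-+ N X Y) ⟩
    (I n - negPow N X) + (negPow N X + negPow N Y)  ≈⟨ sub-add-cancel (I n) _ _ ⟩
    I n + negPow N Y                                ≈⟨ +-congˡ (sym (-‿involutive _)) ⟩
    I n - negPow (suc N) Y ∎
    where
    x : AF
    x = a ⊖ I
    X : Carrier
    X = pow x N n
    Y : Carrier
    Y = pow x (suc N) n
    -- a ⋆ x^{⋆N} = x^{⋆N} + x^{⋆(N+1)} since a = I + x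
    a⋆X : (a ⋆ pow x N) n ≈ X + Y
    a⋆X = begin
      (a ⋆ pow x N) n ≈⟨ star-cong (λ m _ → sym (add-sub-cancel (a m) (I m))) (λ _ _ → refl) n 0<n ⟩
      ((I ⊕ x) ⋆ pow x N) n ≈⟨ star-+ˡ I x (pow x N) n ⟩
      (I ⋆ pow x N) n + (x ⋆ pow x N) n ≈⟨ +-congʳ (star-Iˡ (pow x N) n 0<n) ⟩
      X + Y ∎

  sub-I-M : ∀ a → InIM a → (a ⊖ I) 1 ≈ 0#
  sub-I-M a a1≈1 = trans (+-congʳ a1≈1) (-‿inverseʳ 1#)

  log-as-series : ∀ a → InIM a → ∀ n d → 0 < d → d ≤ n → logA a d ≈ series coeff (a ⊖ I) n d
  log-as-series a a1≈1 n d 0<d d≤n = sym (series-trunc (a ⊖ I) (sub-I-M a a1≈1) coeff d n 0<d d≤n)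

  log-M : ∀ a → InIM a → InM (logA a)
  log-M a a1≈1 = trans (+-identityˡ _) (*-zero-right (pow-nil (a ⊖ I) (sub-I-M a a1≈1) zero 1 (s≤s z≤n) ≤-refl))

  log-cong : ∀ a b → a ≃ b → logA a ≃ logA b
  log-cong a b a≃b m 0<m = sum-cong m (λ k _ → *-congˡ (pow-cong (λ n 0<n → +-congʳ (a≃b n 0<n)) (suc k) m 0<m))

  Ψ-local : ∀ a b N → (∀ d → d ∣ N → a d ≈ b d) → Ψ a N ≈ Ψ b N
  Ψ-local a b N a≈b = star-local u u (logA a) (logA b) N (λ _ _ → refl)
    (λ d d∣N → sum-cong d (λ k _ → *-congˡ (pow-local (a ⊖ I) (b ⊖ I) N (λ e e∣N → +-congʳ (a≈b e e∣N)) (suc k) d d∣N)))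

  Ψ-M : ∀ a → InIM a → InM (Ψ a)
  Ψ-M a a1≈1 = trans (+-identityˡ _) (trans (*-identityˡ _) (log-M a a1≈1))

  Ψ-cong : ∀ a b → a ≃ b → Ψ a ≃ Ψ b
  Ψ-cong a b a≃b = star-cong (λ _ _ → refl) (log-cong a b a≃b)

  InIM-⋆ : ∀ a b → InIM a → InIM b → InIM (a ⋆ b)
  InIM-⋆ a b a1≈1 b1≈1 = trans (+-identityˡ _) (trans (*-cong a1≈1 b1≈1) (*-identityˡ 1#))

  -- The Möbius function μ = Σ_k (-(u - I))^{⋆k}, the ⋆-inverse of u.

  geometric-trunc : ∀ y → y 1 ≈ 0# → ∀ d N → 0 < d → d ≤ N → geometric y N d ≈ geometric y d d
  geometric-trunc y y1≈0 d N 0<d d≤N = sum-extend d N d≤N vanish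
    where
    vanish : ∀ k → d ≤ k → k < N → negPow k (pow y k d) ≈ 0#
    vanish zero d≤0 _ = ⊥-elim (<-irrefl ≡.refl (≤-trans 0<d d≤0))
    vanish (suc k) d≤k _ = trans (negPow-cong (suc k) (pow-nil y y1≈0 k d 0<d d≤k)) (negPow-0 (suc k))

  μ : AF
  μ m = geometric (u ⊖ I) m m

  u⋆μ : (u ⋆ μ) ≃ I
  u⋆μ (suc n') 0<n = begin
    (u ⋆ μ) n ≈⟨ star-local u u μ (geometric y n) n (λ _ _ → refl)
                   (λ d d∣n → sym (geometric-trunc y y1≈0 d n (divisor-pos 0<n d∣n) (∣⇒≤ d∣n))) ⟩
    (u ⋆ geometric y n) n ≈⟨ telescope u n n 0<n ⟩
    I n - negPow n (pow y n n) ≈⟨ +-congˡ (-‿cong (trans (negPow-cong n (pow-nil y y1≈0 n' n 0<n ≤-refl)) (negPow-0 n))) ⟩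
    I n - 0# ≈⟨ trans (+-congˡ -0≈0) (+-identityʳ _) ⟩
    I n ∎
    where
    n : ℕ
    n = suc n'
    y : AF
    y = u ⊖ I
    y1≈0 : y 1 ≈ 0#
    y1≈0 = sub-I-M u refl

  u⋆μ⋆f : ∀ f → (u ⋆ (μ ⋆ f)) ≃ f
  u⋆μ⋆f f n 0<n = trans (sym (star-assoc u μ f n 0<n)) (trans (star-cong u⋆μ (λ _ _ → refl) n 0<n) (star-Iˡ f n 0<n))

  μ⋆-M : ∀ f → InM f → InM (μ ⋆ f)
  μ⋆-M f f1≈0 = trans (+-identityˡ _) (*-zero-right f1≈0)

  divisor-induction : ∀ N (P : ℕ → Set ℓ) → (∀ d → d ∣ N → (∀ e → e ∣ d → e < d → P e) → P d) → ∀ d → d ∣ N → P d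
  divisor-induction N P step = <-rec (λ d → d ∣ N → P d) (λ d rec d∣N → step d d∣N (λ e e∣d e<d → rec e<d (∣-trans e∣d d∣N)))

  star-cancel-local : ∀ c h h' N → 0 < N → c 1 ≈ 1# → (∀ d → d ∣ N → (c ⋆ h) d ≈ (c ⋆ h') d) → ∀ d → d ∣ N → h d ≈ h' d
  star-cancel-local c h h' N 0<N c1≈1 c⋆h≈ = divisor-induction N (λ d → h d ≈ h' d) step
    where
    step : ∀ d → d ∣ N → (∀ e → e ∣ d → e < d → h e ≈ h' e) → h d ≈ h' d
    step zero 0∣N _ = ⊥-elim (<-irrefl ≡.refl (divisor-pos 0<N 0∣N))
    step (suc d) d∣N ih = begin
      h (suc d)        ≈⟨ sym (trans (*-congˡ c1≈1) (*-identityʳ _)) ⟩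
      h (suc d) * c 1  ≈⟨ +-cancelʳ P _ _ last-terms ⟩
      h' (suc d) * c 1 ≈⟨ trans (*-congˡ c1≈1) (*-identityʳ _) ⟩
      h' (suc d) ∎
      where
      P : Carrier
      P = sum1 (dirTerm h c (suc d)) d
      last-terms : h (suc d) * c 1 + P ≈ h' (suc d) * c 1 + P
      last-terms = begin
        h (suc d) * c 1 + P ≈⟨ +-comm _ _ ⟩
        P + h (suc d) * c 1 ≈⟨ sym (star-last h c d) ⟩
        (h ⋆ c) (suc d)     ≈⟨ star-comm h c (suc d) (s≤s z≤n) ⟩
        (c ⋆ h) (suc d)     ≈⟨ c⋆h≈ (suc d) d∣N ⟩
        (c ⋆ h') (suc d)    ≈⟨ star-comm c h' (suc d) (s≤s z≤n) ⟩
        (h' ⋆ c) (suc d)    ≈⟨ star-last h' c d ⟩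
        sum1 (dirTerm h' c (suc d)) d + h' (suc d) * c 1
          ≈⟨ +-congʳ (sym (star-proper-local h h' c c d ih (λ _ _ → refl))) ⟩
        P + h' (suc d) * c 1 ≈⟨ +-comm _ _ ⟩
        h' (suc d) * c 1 + P ∎

  star-cancel : ∀ c h h' → c 1 ≈ 1# → (c ⋆ h) ≃ (c ⋆ h') → h ≃ h'
  star-cancel c h h' c1≈1 c⋆h≃ n 0<n =
    star-cancel-local c h h' n 0<n c1≈1 (λ d d∣n → c⋆h≃ d (divisor-pos 0<n d∣n)) n ∣-refl

  -- The projection Q n a, which keeps the values of a at arguments coprime
  -- to n and is 0 elsewhere.  Kept abstract; only Q-⊥ and Q-not-⊥ are used.

  abstract
    Q : ℕ → AF → AF
    Q n a k with coprime? k n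
    ... | yes _ = a k
    ... | no _ = 0#

    Q-⊥ : ∀ n a k → Coprime k n → Q n a k ≈ a k
    Q-⊥ n a k k⊥n with coprime? k n
    ... | yes _ = refl
    ... | no k⊥̸n = ⊥-elim (k⊥̸n k⊥n)

    Q-not-⊥ : ∀ n a k → ¬ Coprime k n → Q n a k ≈ 0#
    Q-not-⊥ n a k k⊥̸n with coprime? k n
    ... | yes k⊥n = ⊥-elim (k⊥̸n k⊥n)
    ... | no _ = refl

  Q-by-cases : ∀ n k {x y} → (Coprime k n → x ≈ y) → (¬ Coprime k n → x ≈ y) → x ≈ y
  Q-by-cases n k coprime-case other-case with coprime? k n
  ... | yes k⊥n = coprime-case k⊥n
  ... | no k⊥̸n = other-case k⊥̸n

  Q-I : ∀ n k → Q n I k ≈ I k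
  Q-I n k = Q-by-cases n k (Q-⊥ n I k)
    (λ k⊥̸n → trans (Q-not-⊥ n I k k⊥̸n) (sym (I-≢1 k (λ { ≡.refl → k⊥̸n (1-coprimeTo n) }))))

  Q-IM : ∀ n a → InIM a → InIM (Q n a)
  Q-IM n a a1≈1 = trans (Q-⊥ n a 1 (1-coprimeTo n)) a1≈1

  Q-⊖I : ∀ n a k → Q n (a ⊖ I) k ≈ (Q n a ⊖ I) k
  Q-⊖I n a k = Q-by-cases n k
    (λ k⊥n → trans (Q-⊥ n _ k k⊥n) (+-congʳ (sym (Q-⊥ n a k k⊥n))))
    (λ k⊥̸n → trans (Q-not-⊥ n _ k k⊥̸n) (sym (begin
      Q n a k - I k ≈⟨ +-cong (Q-not-⊥ n a k k⊥̸n) (-‿cong (trans (sym (Q-I n k)) (Q-not-⊥ n I k k⊥̸n))) ⟩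
      0# - 0#       ≈⟨ -‿inverseʳ 0# ⟩
      0# ∎)))

  -- Q n is a ring endomorphism of (𝔸, ⋆): at k coprime to n all divisors
  -- of k are coprime to n; otherwise every summand d, k/d has a factor not
  -- coprime to n.
  Q-⋆ : ∀ n a b k → 0 < k → Q n (a ⋆ b) k ≈ (Q n a ⋆ Q n b) k
  Q-⋆ n a b k 0<k = Q-by-cases n k
    (λ k⊥n → trans (Q-⊥ n _ k k⊥n)
      (star-local a (Q n a) b (Q n b) k (λ d d∣k → sym (Q-⊥ n a d (coprime-∣ d∣k k⊥n)))
                                        (λ d d∣k → sym (Q-⊥ n b d (coprime-∣ d∣k k⊥n)))))
    (λ k⊥̸n → trans (Q-not-⊥ n _ k k⊥̸n) (sym (sum-zero k (vanish k⊥̸n))))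
    where
    vanish : ¬ Coprime k n → ∀ j → j < k → dirTerm (Q n a) (Q n b) k (suc j) ≈ 0#
    vanish k⊥̸n j _ = dirTerm-lift (Q n a) (Q n b) a b a b k (λ _ _ → 0#) refl j λ j∣k →
      Q-by-cases n (suc j)
        (λ j⊥n → Q-by-cases n (k / suc j)
          (λ q⊥n → ⊥-elim (k⊥̸n (≡.subst (λ z → Coprime z n) (m*[n/m]≡n j∣k) (coprime-* j⊥n q⊥n))))
          (λ q⊥̸n → *-zero-right (Q-not-⊥ n b _ q⊥̸n)))
        (λ j⊥̸n → *-zero-left (Q-not-⊥ n a _ j⊥̸n))

  Q-pow : ∀ n x j → pow (Q n x) j ≃ Q n (pow x j)
  Q-pow n x zero k _ = sym (Q-I n k)
  Q-pow n x (suc j) k 0<k = trans (star-cong (λ _ _ → refl) (Q-pow n x j) k 0<k) (sym (Q-⋆ n x (pow x j) k 0<k))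

  Q-log : ∀ n a → logA (Q n a) ≃ Q n (logA a)
  Q-log n a m 0<m = trans
    (sum-cong m (λ k _ → *-congˡ (trans (pow-cong (λ j _ → sym (Q-⊖I n a j)) (suc k) m 0<m) (Q-pow n (a ⊖ I) (suc k) m 0<m))))
    Q-outside
    where
    Q-outside : sum1 (λ k → coeff k * Q n (pow (a ⊖ I) k) m) m ≈ Q n (logA a) m
    Q-outside = Q-by-cases n m
      (λ m⊥n → trans (sum-cong m (λ k _ → *-congˡ (Q-⊥ n _ m m⊥n))) (sym (Q-⊥ n _ m m⊥n)))
      (λ m⊥̸n → trans (sum-zero m (λ k _ → *-zero-right (Q-not-⊥ n _ m m⊥̸n))) (sym (Q-not-⊥ n _ m m⊥̸n)))

  -- For d₁ coprime to n and d₂ ∣ n, the divisors of d₁ d₂ coprime to n are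
  -- exactly the divisors of d₁, so (u ⋆ Q n L)(d₁ d₂) = (u ⋆ L)(d₁).
  u⋆Q : ∀ n L d₁ d₂ → Coprime (suc d₁) n → suc d₂ ∣ n → (u ⋆ Q n L) (suc d₁ *ℕ suc d₂) ≈ (u ⋆ L) (suc d₁)
  u⋆Q n L d₁ d₂ d₁⊥n d₂∣n = begin
    (u ⋆ Q n L) k            ≈⟨ star-comm u (Q n L) k (s≤s z≤n) ⟩
    sum1 (dirTerm (Q n L) u k) k ≈⟨ sum-cong k (λ e _ → summand e) ⟩
    sum1 (dirTerm L u (suc d₁)) k
      ≈⟨ sum-extend (suc d₁) k (m≤m*n (suc d₁) (suc d₂))
           (λ e d₁≤e _ → dirTerm-∤ L u (suc d₁) e (λ e∣d₁ → <-irrefl ≡.refl (≤-trans (s≤s d₁≤e) (∣⇒≤ e∣d₁)))) ⟩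
    (L ⋆ u) (suc d₁)         ≈⟨ star-comm L u (suc d₁) (s≤s z≤n) ⟩
    (u ⋆ L) (suc d₁) ∎
    where
    k : ℕ
    k = suc d₁ *ℕ suc d₂
    summand : ∀ e → dirTerm (Q n L) u k (suc e) ≈ dirTerm L u (suc d₁) (suc e)
    summand e with suc e ∣? k | suc e ∣? suc d₁
    ... | yes _ | yes e∣d₁ = *-congʳ (Q-⊥ n L (suc e) (coprime-∣ e∣d₁ d₁⊥n))
    ... | yes e∣k | no e∤d₁ = Q-by-cases n (suc e) (λ e⊥n → ⊥-elim (e∤d₁ (coprime-cancel e∣k e⊥n d₂∣n)))
                                                   (λ e⊥̸n → *-zero-left (Q-not-⊥ n L (suc e) e⊥̸n))
    ... | no e∤k | yes e∣d₁ = ⊥-elim (e∤k (∣-trans e∣d₁ (m∣m*n (suc d₂))))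
    ... | no _ | no _ = refl

  Ψ-Q : ∀ n a d₁ d₂ → Coprime (suc d₁) n → suc d₂ ∣ n → Ψ (Q n a) (suc d₁ *ℕ suc d₂) ≈ Ψ a (suc d₁)
  Ψ-Q n a d₁ d₂ d₁⊥n d₂∣n = trans (star-cong (λ _ _ → refl) (Q-log n a) (suc d₁ *ℕ suc d₂) (s≤s z≤n)) (u⋆Q n (logA a) d₁ d₂ d₁⊥n d₂∣n)

  -- For coprime m, n and d₁ ∣ m, d₂ ∣ n:  (Q n a ⋆ Q m a)(d₁ d₂) = a(d₁) a(d₂),
  -- the only divisor pair (e, d₁d₂/e) with e ⊥ n and d₁d₂/e ⊥ m being (d₁, d₂).
  Q⋆Q : ∀ m n a d₁ d₂ → Coprime m n → suc d₁ ∣ m → suc d₂ ∣ n → (Q n a ⋆ Q m a) (suc d₁ *ℕ suc d₂) ≈ a (suc d₁) * a (suc d₂)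
  Q⋆Q m n a d₁ d₂ m⊥n d₁∣m d₂∣n = trans (sum-single k d₁ (m≤m*n (suc d₁) (suc d₂)) others) main
    where
    k : ℕ
    k = suc d₁ *ℕ suc d₂
    main : dirTerm (Q n a) (Q m a) k (suc d₁) ≈ a (suc d₁) * a (suc d₂)
    main = trans (dirTerm-∣ (Q n a) (Q m a) k d₁ (m∣m*n (suc d₂)))
      (*-cong (Q-⊥ n a (suc d₁) (coprime-∣ d₁∣m m⊥n))
        (trans (reflexive (≡.cong (Q m a) (≡.trans (≡.cong (_/ suc d₁) (*ℕ-comm (suc d₁) (suc d₂))) (m*n/n≡m (suc d₂) (suc d₁)))))
          (Q-⊥ m a (suc d₂) (coprime-∣ d₂∣n (Cop.sym m⊥n)))))
    others : ∀ j → j < k → j ≢ d₁ → dirTerm (Q n a) (Q m a) k (suc j) ≈ 0#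
    others j _ j≢d₁ = dirTerm-lift (Q n a) (Q m a) a a a a k (λ _ _ → 0#) refl j λ j∣k →
      Q-by-cases n (suc j)
        (λ j⊥n → Q-by-cases m (k / suc j)
          (λ q⊥m → ⊥-elim (j≢d₁ (suc-injective (factor-eq (coprime-cancel j∣k j⊥n d₂∣n)
                     (coprime-cancel (≡.subst (k / suc j ∣_) (*ℕ-comm (suc d₁) (suc d₂)) (m/n∣m j∣k)) q⊥m d₁∣m)
                     (m*[n/m]≡n j∣k)))))
          (λ q⊥̸m → *-zero-right (Q-not-⊥ m a _ q⊥̸m)))
        (λ j⊥̸n → *-zero-left (Q-not-⊥ n a _ j⊥̸n))

  module WithInverses (inv-correct : ∀ k → natCast (suc k) * inv k ≈ 1#) where

    natCast-cancel : ∀ k {x y} → natCast (suc k) * x ≈ natCast (suc k) * y → x ≈ y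
    natCast-cancel k {x} {y} kx≈ky = begin
      x                             ≈⟨ sym (inv-* x) ⟩
      inv k * (natCast (suc k) * x) ≈⟨ *-congˡ kx≈ky ⟩
      inv k * (natCast (suc k) * y) ≈⟨ inv-* y ⟩
      y ∎
      where
      inv-* : ∀ z → inv k * (natCast (suc k) * z) ≈ z
      inv-* z = trans (solve 3 (λ a b z → b :* (a :* z) := (a :* b) :* z) refl _ _ _)
                      (trans (*-congʳ (inv-correct k)) (*-identityˡ z))

    -- D is injective on 𝕄, because Ω(n) ≥ 1 is invertible for n ≥ 2.
    D-injective : ∀ f g → InM f → InM g → D f ≃ D g → f ≃ g
    D-injective f g f1≈0 g1≈0 Df≃Dg (suc zero) _ = trans f1≈0 (sym g1≈0)
    D-injective f g f1≈0 g1≈0 Df≃Dg (suc (suc n)) 0<n with Ω-pos n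
    ... | k , Ω≡ = natCast-cancel k (≡.subst (λ z → natCast z * f m ≈ natCast z * g m) Ω≡ (Df≃Dg m 0<n))
      where
        m : ℕ
        m = suc (suc n)

    -- The coefficient (-1)^j / (j+1) of log cancels the factor j+1 of the power rule.
    coeff-natCast : ∀ j X → coeff (suc j) * (natCast (suc j) * X) ≈ negPow j X
    coeff-natCast j X = trans (negPow-*ˡ j (inv j) _) (negPow-cong j (begin
      inv j * (natCast (suc j) * X) ≈⟨ solve 3 (λ a b x → b :* (a :* x) := (a :* b) :* x) refl _ _ _ ⟩
      (natCast (suc j) * inv j) * X ≈⟨ *-congʳ (inv-correct j) ⟩
      1# * X                        ≈⟨ *-identityˡ X ⟩
      X ∎))

    D-log-series : ∀ y N n → 0 < n → D (series coeff y N) n ≈ (geometric y N ⋆ D y) n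
    D-log-series y N n 0<n = begin
      D (series coeff y N) n ≈⟨ D-series coeff y N n 0<n ⟩
      sum1 (λ k → coeff k * (natCast k * (pow y (k ∸ 1) ⋆ D y) n)) N
        ≈⟨ sum-cong N (λ k _ → trans (coeff-natCast k _) (sym (star-signedˡ k (pow y k) (D y) n))) ⟩
      sum1 (λ k → (signed (k ∸ 1) (pow y (k ∸ 1)) ⋆ D y) n) N
        ≈⟨ sym (star-sumˡ (λ k → signed (k ∸ 1) (pow y (k ∸ 1))) (D y) N n) ⟩
      (geometric y N ⋆ D y) n ∎

    -- The key identity  a ⋆ D(log a) = D a  for a ∈ I + 𝕄:  D(log a) is
    -- (Σ_k (-(a-I))^{⋆k}) ⋆ D(a - I), and a ⋆ Σ_k (-(a-I))^{⋆k} telescopes to I.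
    log-identity : ∀ a → InIM a → ∀ n → 0 < n → (a ⋆ D (logA a)) n ≈ D a n
    log-identity a a1≈1 (suc n') 0<n = begin
      (a ⋆ D (logA a)) n
        ≈⟨ star-local a a _ _ n (λ _ _ → refl) (λ d d∣n → *-congˡ (log-as-series a a1≈1 n d (divisor-pos 0<n d∣n) (∣⇒≤ d∣n))) ⟩
      (a ⋆ D (series coeff x n)) n
        ≈⟨ star-local a a _ _ n (λ _ _ → refl) (λ d d∣n → D-log-series x n d (divisor-pos 0<n d∣n)) ⟩
      (a ⋆ (geometric x n ⋆ D x)) n ≈⟨ sym (star-assoc a (geometric x n) (D x) n 0<n) ⟩
      ((a ⋆ geometric x n) ⋆ D x) n
        ≈⟨ star-local _ (I ⊖ signed n (pow x n)) (D x) (D x) n (λ d d∣n → telescope a n d (divisor-pos 0<n d∣n)) (λ _ _ → refl) ⟩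
      ((I ⊕ negate (signed n (pow x n))) ⋆ D x) n ≈⟨ star-+ˡ I (negate (signed n (pow x n))) (D x) n ⟩
      (I ⋆ D x) n + (negate (signed n (pow x n)) ⋆ D x) n
        ≈⟨ +-cong (star-Iˡ (D x) n 0<n) (trans (star-negˡ _ (D x) n) (-‿cong (star-signedˡ n (pow x n) (D x) n))) ⟩
      D x n - negPow n ((pow x n ⋆ D x) n)
        ≈⟨ +-congˡ (-‿cong (trans (negPow-cong n (pow-nil-star x (sub-I-M a a1≈1) n' (D x) n 0<n ≤-refl)) (negPow-0 n))) ⟩
      D x n - 0#    ≈⟨ trans (+-congˡ -0≈0) (+-identityʳ _) ⟩
      D x n         ≈⟨ D-⊖ a I n ⟩
      D a n - D I n ≈⟨ +-congˡ (trans (-‿cong (D-I n)) -0≈0) ⟩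
      D a n + 0#    ≈⟨ +-identityʳ _ ⟩
      D a n ∎
      where
      n : ℕ
      n = suc n'
      x : AF
      x = a ⊖ I

    log-unique : ∀ a g → InIM a → InM g → (a ⋆ D g) ≃ D a → logA a ≃ g
    log-unique a g a1≈1 g1≈0 a⋆Dg≃Da = D-injective _ _ (log-M a a1≈1) g1≈0
      (star-cancel a _ _ a1≈1 (λ n 0<n → trans (log-identity a a1≈1 n 0<n) (sym (a⋆Dg≃Da n 0<n))))

    -- log turns ⋆ into +: by Leibniz, (a ⋆ b) ⋆ D(log a + log b) = D(a ⋆ b).
    log-hom : ∀ a b → InIM a → InIM b → logA (a ⋆ b) ≃ (logA a ⊕ logA b)
    log-hom a b a1≈1 b1≈1 = log-unique (a ⋆ b) (La ⊕ Lb) (InIM-⋆ a b a1≈1 b1≈1)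
      (trans (+-cong (log-M a a1≈1) (log-M b b1≈1)) (+-identityˡ 0#)) identity
      where
      La : AF
      La = logA a
      Lb : AF
      Lb = logA b
      identity : ((a ⋆ b) ⋆ D (La ⊕ Lb)) ≃ D (a ⋆ b)
      identity n 0<n = sym (begin
        D (a ⋆ b) n ≈⟨ D-leibniz a b n 0<n ⟩
        (D a ⋆ b) n + (a ⋆ D b) n
          ≈⟨ +-cong (star-comm (D a) b n 0<n) (sym (star-cong (λ _ _ → refl) (log-identity b b1≈1) n 0<n)) ⟩
        (b ⋆ D a) n + (a ⋆ (b ⋆ D Lb)) n ≈⟨ +-congʳ (sym (star-cong (λ _ _ → refl) (log-identity a a1≈1) n 0<n)) ⟩
        (b ⋆ (a ⋆ D La)) n + (a ⋆ (b ⋆ D Lb)) n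
          ≈⟨ +-cong (sym (star-assoc b a (D La) n 0<n)) (sym (star-assoc a b (D Lb) n 0<n)) ⟩
        ((b ⋆ a) ⋆ D La) n + ((a ⋆ b) ⋆ D Lb) n ≈⟨ +-congʳ (star-cong (star-comm b a) (λ _ _ → refl) n 0<n) ⟩
        ((a ⋆ b) ⋆ D La) n + ((a ⋆ b) ⋆ D Lb) n ≈⟨ sym (star-+ʳ (a ⋆ b) (D La) (D Lb) n) ⟩
        ((a ⋆ b) ⋆ (D La ⊕ D Lb)) n ≈⟨ star-local (a ⋆ b) (a ⋆ b) _ _ n (λ _ _ → refl) (λ m _ → sym (D-⊕ La Lb m)) ⟩
        ((a ⋆ b) ⋆ D (La ⊕ Lb)) n ∎)

    Ψ-hom : ∀ a b → InIM a → InIM b → Ψ (a ⋆ b) ≃ (Ψ a ⊕ Ψ b)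
    Ψ-hom a b a1≈1 b1≈1 n 0<n = trans (star-cong (λ _ _ → refl) (log-hom a b a1≈1 b1≈1) n 0<n) (star-+ʳ u (logA a) (logA b) n)

    -- log is injective, locally on the divisors of N: by the key identity
    -- Ω(d) a(d) = (a ⋆ D(log a))(d) is determined by log a and by a at the
    -- proper divisors of d, and Ω(d) is invertible for d ≥ 2.
    log-injective-local : ∀ a b N → 0 < N → InIM a → InIM b →
      (∀ d → d ∣ N → logA a d ≈ logA b d) → ∀ d → d ∣ N → a d ≈ b d
    log-injective-local a b N 0<N a1≈1 b1≈1 La≈Lb = divisor-induction N (λ d → a d ≈ b d) step
      where
      step : ∀ d → d ∣ N → (∀ e → e ∣ d → e < d → a e ≈ b e) → a d ≈ b d
      step zero 0∣N _ = ⊥-elim (<-irrefl ≡.refl (divisor-pos 0<N 0∣N))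
      step (suc zero) _ _ = trans a1≈1 (sym b1≈1)
      step (suc (suc m)) d∣N ih with Ω-pos m
      ... | k , Ω≡ = natCast-cancel k (≡.subst (λ z → natCast z * a d ≈ natCast z * b d) Ω≡ (begin
        D a d                                       ≈⟨ sym (log-identity a a1≈1 d (s≤s z≤n)) ⟩
        (a ⋆ D (logA a)) d                          ≈⟨ star-last a _ (suc m) ⟩
        proper a (logA a) + a d * D (logA a) 1      ≈⟨ +-congˡ (*-zero-right (zeroˡ _)) ⟩
        proper a (logA a) + 0#
          ≈⟨ +-congʳ (star-proper-local a b _ _ (suc m) ih (λ e e∣d → *-congˡ (La≈Lb e (∣-trans e∣d d∣N)))) ⟩
        proper b (logA b) + 0#                      ≈⟨ +-congˡ (sym (*-zero-right (zeroˡ _))) ⟩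
        proper b (logA b) + b d * D (logA b) 1      ≈⟨ sym (star-last b _ (suc m)) ⟩
        (b ⋆ D (logA b)) d                          ≈⟨ log-identity b b1≈1 d (s≤s z≤n) ⟩
        D b d ∎))
        where
        d : ℕ
        d = suc (suc m)
        proper : AF → AF → Carrier
        proper c L = sum1 (dirTerm c (D L) d) (suc m)

    Ψ-injective-local : ∀ a b N → 0 < N → InIM a → InIM b → (∀ d → d ∣ N → Ψ a d ≈ Ψ b d) → ∀ d → d ∣ N → a d ≈ b d
    Ψ-injective-local a b N 0<N a1≈1 b1≈1 Ψa≈Ψb =
      log-injective-local a b N 0<N a1≈1 b1≈1 (star-cancel-local u (logA a) (logA b) N 0<N refl Ψa≈Ψb)

    Ψ-injective : ∀ a b → InIM a → InIM b → Ψ a ≃ Ψ b → a ≃ b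
    Ψ-injective a b a1≈1 b1≈1 Ψa≃Ψb n 0<n =
      Ψ-injective-local a b n 0<n a1≈1 b1≈1 (λ d d∣n → Ψa≃Ψb d (divisor-pos 0<n d∣n)) n ∣-refl

    -- The exponential exp g = I + Σ_{k ≥ 1} g^{⋆k} / k!, the inverse of log.

    expCoeff : ℕ → Carrier
    expCoeff zero = 1#
    expCoeff (suc k) = expCoeff k * inv k

    expCoeff-natCast : ∀ j X → expCoeff (suc j) * (natCast (suc j) * X) ≈ expCoeff j * X
    expCoeff-natCast j X = begin
      (expCoeff j * inv j) * (natCast (suc j) * X)
        ≈⟨ solve 4 (λ e i n x → (e :* i) :* (n :* x) := e :* ((n :* i) :* x)) refl _ _ _ _ ⟩
      expCoeff j * ((natCast (suc j) * inv j) * X) ≈⟨ *-congˡ (trans (*-congʳ (inv-correct j)) (*-identityˡ X)) ⟩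
      expCoeff j * X ∎

    expF : AF → AF
    expF g m = I m + series expCoeff g m m

    expF-IM : ∀ g → InM g → InIM (expF g)
    expF-IM g g1≈0 = trans (+-congˡ (trans (+-identityˡ _) (*-zero-right (pow-nil g g1≈0 zero 1 (s≤s z≤n) ≤-refl))))
                           (+-identityʳ 1#)

    D-expF : ∀ g → InM g → ∀ n → 0 < n → D (expF g) n ≈ (expF g ⋆ D g) n
    D-expF g g1≈0 (suc M) 0<n = begin
      D (expF g) n ≈⟨ D-⊕ I s n ⟩
      D I n + D s n ≈⟨ +-cong (D-I n) (D-series expCoeff g n n 0<n) ⟩
      0# + sum1 (λ k → expCoeff k * (natCast k * (pow g (k ∸ 1) ⋆ D g) n)) n ≈⟨ +-identityˡ _ ⟩
      sum1 (λ k → expCoeff k * (natCast k * (pow g (k ∸ 1) ⋆ D g) n)) n ≈⟨ sum-cong n (λ j _ → expCoeff-natCast j _) ⟩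
      sum1 (λ k → T (k ∸ 1)) n ≈⟨ sum-shift T M ⟩
      T 0 + sum1 T M
        ≈⟨ +-congˡ (sym (sum-extend M n (m≤n⇒m≤1+n ≤-refl) (λ k M≤k _ → *-zero-right (pow-nil-star g g1≈0 k (D g) n 0<n (s≤s M≤k))))) ⟩
      T 0 + sum1 T n ≈⟨ +-cong (*-identityˡ _) (sum-cong n (λ k _ → sym (star-scaleˡ (expCoeff (suc k)) (pow g (suc k)) (D g) n))) ⟩
      (I ⋆ D g) n + sum1 (λ k → (scale (expCoeff k) (pow g k) ⋆ D g) n) n
        ≈⟨ +-congˡ (sym (star-sumˡ (λ k → scale (expCoeff k) (pow g k)) (D g) n n)) ⟩
      (I ⋆ D g) n + (s ⋆ D g) n ≈⟨ sym (star-+ˡ I s (D g) n) ⟩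
      ((I ⊕ s) ⋆ D g) n
        ≈⟨ star-local (I ⊕ s) (expF g) (D g) (D g) n
             (λ d d∣n → +-congˡ (series-trunc g g1≈0 expCoeff d n (divisor-pos 0<n d∣n) (∣⇒≤ d∣n))) (λ _ _ → refl) ⟩
      (expF g ⋆ D g) n ∎
      where
      n : ℕ
      n = suc M
      s : AF
      s = series expCoeff g n
      T : ℕ → Carrier
      T j = expCoeff j * (pow g j ⋆ D g) n

    log-expF : ∀ g → InM g → logA (expF g) ≃ g
    log-expF g g1≈0 = log-unique (expF g) g (expF-IM g g1≈0) g1≈0 (λ n 0<n → sym (D-expF g g1≈0 n 0<n))

    -- Ψ is onto 𝕄: Ψ(exp(μ ⋆ f)) = u ⋆ μ ⋆ f = f.
    Ψ-surjective : ∀ f → InM f → Σ AF (λ a → InIM a × Ψ a ≃ f)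
    Ψ-surjective f f1≈0 = expF g , expF-IM g g1≈0 ,
      (λ n 0<n → trans (star-cong (λ _ _ → refl) (log-expF g g1≈0) n 0<n) (u⋆μ⋆f f n 0<n))
      where
      g : AF
      g = μ ⋆ f
      g1≈0 : InM g
      g1≈0 = μ⋆-M f f1≈0

    -- For coprime m, n put
    -- w = Q n a ⋆ Q m a; on the divisors d₁ d₂ of m n (d₁ ∣ m, d₂ ∣ n) one has
    -- w(d₁ d₂) = a(d₁) a(d₂) (Q⋆Q) and Ψ w (d₁ d₂) = Ψ a (d₁) + Ψ a (d₂).

    Ψ-Q⋆Q : ∀ m n a d₁ d₂ → InIM a → Coprime m n → suc d₁ ∣ m → suc d₂ ∣ n →
      Ψ (Q n a ⋆ Q m a) (suc d₁ *ℕ suc d₂) ≈ Ψ a (suc d₁) + Ψ a (suc d₂)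
    Ψ-Q⋆Q m n a d₁ d₂ a1≈1 m⊥n d₁∣m d₂∣n = begin
      Ψ (Q n a ⋆ Q m a) k       ≈⟨ Ψ-hom (Q n a) (Q m a) (Q-IM n a a1≈1) (Q-IM m a a1≈1) k (s≤s z≤n) ⟩
      Ψ (Q n a) k + Ψ (Q m a) k ≈⟨ +-congʳ (Ψ-Q n a d₁ d₂ (coprime-∣ d₁∣m m⊥n) d₂∣n) ⟩
      Ψ a (suc d₁) + Ψ (Q m a) k
        ≈⟨ +-congˡ (trans (reflexive (≡.cong (Ψ (Q m a)) (*ℕ-comm (suc d₁) (suc d₂))))
                          (Ψ-Q m a d₂ d₁ (coprime-∣ d₂∣n (Cop.sym m⊥n)) d₁∣m)) ⟩
      Ψ a (suc d₁) + Ψ a (suc d₂) ∎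
      where
        k : ℕ
        k = suc d₁ *ℕ suc d₂

    multiplicative⇒additive : ∀ a → InIM a → Multiplicative a → Additive (Ψ a)
    multiplicative⇒additive a a1≈1 (_ , a-mult) (suc m') (suc n') _ _ m⊥n = begin
      Ψ a (m *ℕ n) ≈⟨ Ψ-local a w (m *ℕ n) a≈w ⟩
      Ψ w (m *ℕ n) ≈⟨ Ψ-Q⋆Q m n a m' n' a1≈1 m⊥n ∣-refl ∣-refl ⟩
      Ψ a m + Ψ a n ∎
      where
      m : ℕ
      m = suc m'
      n : ℕ
      n = suc n'
      w : AF
      w = Q n a ⋆ Q m a
      a≈w : ∀ k → k ∣ m *ℕ n → a k ≈ w k
      a≈w k k∣mn = ≡.subst (λ z → a z ≈ w z) (≡.sym k≡d₁d₂)
        (trans (a-mult _ _ (s≤s z≤n) (s≤s z≤n) (coprime-divisors m⊥n d₁∣m d₂∣n)) (sym (Q⋆Q m n a d₁ d₂ m⊥n d₁∣m d₂∣n)))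
        where open CoprimeSplit (coprime-split m n k (s≤s z≤n) m⊥n k∣mn)

    additive⇒multiplicative : ∀ a → InIM a → Additive (Ψ a) → Multiplicative a
    additive⇒multiplicative a a1≈1 Ψa-add = a1≈1 , a-mult
      where
      a-mult : ∀ m n → 0 < m → 0 < n → Coprime m n → a (m *ℕ n) ≈ a m * a n
      a-mult (suc m') (suc n') _ _ m⊥n =
        trans (Ψ-injective-local a w (m *ℕ n) (s≤s z≤n) a1≈1 w1≈1 Ψa≈Ψw (m *ℕ n) ∣-refl) (Q⋆Q m n a m' n' m⊥n ∣-refl ∣-refl)
        where
        m : ℕ
        m = suc m'
        n : ℕ
        n = suc n'
        w : AF
        w = Q n a ⋆ Q m a
        w1≈1 : InIM w
        w1≈1 = InIM-⋆ (Q n a) (Q m a) (Q-IM n a a1≈1) (Q-IM m a a1≈1)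
        Ψa≈Ψw : ∀ k → k ∣ m *ℕ n → Ψ a k ≈ Ψ w k
        Ψa≈Ψw k k∣mn = ≡.subst (λ z → Ψ a z ≈ Ψ w z) (≡.sym k≡d₁d₂)
          (trans (Ψa-add _ _ (s≤s z≤n) (s≤s z≤n) (coprime-divisors m⊥n d₁∣m d₂∣n)) (sym (Ψ-Q⋆Q m n a d₁ d₂ a1≈1 m⊥n d₁∣m d₂∣n)))
          where open CoprimeSplit (coprime-split m n k (s≤s z≤n) m⊥n k∣mn)

    -- Additive functions lie in 𝕄, since f(1) = f(1 · 1) = f(1) + f(1).
    additive-M : ∀ f → Additive f → InM f
    additive-M f f-add = x+x≈x⇒x≈0 (f 1) (sym (f-add 1 1 (s≤s z≤n) (s≤s z≤n) (1-coprimeTo 1)))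

    additive-cong : ∀ f g → f ≃ g → Additive f → Additive g
    additive-cong f g f≃g f-add (suc m) (suc n) 0<m 0<n m⊥n =
      trans (sym (f≃g _ (s≤s z≤n))) (trans (f-add _ _ 0<m 0<n m⊥n) (+-cong (f≃g _ 0<m) (f≃g _ 0<n)))

    Ψ-onto-additive : ∀ f → Additive f → Σ AF (λ a → Multiplicative a × Ψ a ≃ f)
    Ψ-onto-additive f f-add = multiplicative-preimage (Ψ-surjective f (additive-M f f-add))
      where
      multiplicative-preimage : Σ AF (λ a → InIM a × Ψ a ≃ f) → Σ AF (λ a → Multiplicative a × Ψ a ≃ f)
      multiplicative-preimage (a , a1≈1 , Ψa≃f) =
        a , additive⇒multiplicative a a1≈1 (additive-cong f (Ψ a) (λ n 0<n → sym (Ψa≃f n 0<n)) f-add) , Ψa≃f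

mainTheorem1 : ∀ {c ℓ} (R : CommutativeRing c ℓ) (inv : ℕ → CommutativeRing.Carrier R) →
    (let open CommutativeRing R in let open Arith R inv in ∀ k → natCast (ℕ.suc k) * inv k ≈ 1#) →
    let open CommutativeRing R in
    let open Arith R inv in
    (∀ a → InIM a → InM (Ψ a)) ×
    (∀ a b → a ≃ b → Ψ a ≃ Ψ b) ×
    (∀ a b → InIM a → InIM b → Ψ (a ⋆ b) ≃ (Ψ a ⊕ Ψ b)) ×
    (∀ a b → InIM a → InIM b → Ψ a ≃ Ψ b → a ≃ b) ×
    (∀ f → InM f → Σ AF (λ a → InIM a × Ψ a ≃ f)) ×
    (∀ a → InIM a → (Multiplicative a → Additive (Ψ a)) × (Additive (Ψ a) → Multiplicative a)) ×
    (∀ f → Additive f → Σ AF (λ a → Multiplicative a × Ψ a ≃ f))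
mainTheorem1 R inv inv-correct =
  Ψ-M , Ψ-cong , Ψ-hom , Ψ-injective , Ψ-surjective ,
  (λ a a1≈1 → multiplicative⇒additive a a1≈1 , additive⇒multiplicative a a1≈1) ,
  Ψ-onto-additive
  where
  open ArithmeticalFunctions R inv
  open WithInverses inv-correct
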